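{- Let $s:\{1,\dots,37\}\to\{1,\dots,7\}$ be a map such that the cells of each of the 21 rows receive pairwise distinct values and each of the six non-central circles $\{1,2,5,6,7,11,12\}$, $\{3,4,7,8,9,13,14\}$, $\{10,11,16,17,18,23,24\}$, $\{14,15,20,21,22,27,28\}$, $\{24,25,29,30,31,34,35\}$, $\{26,27,31,32,33,36,37\}$ receives seven pairwise distinct values. Then the cells of the central circle $\{12,13,18,19,20,25,26\}$ also receive pairwise distinct values.
   Context: The Septoku board consists of 37 cells forming a regular hexagon of side 4 in a hexagonal grid, numbered row by row: $1$–$4$ (top row), $5$–$9$, $10$–$15$, $16$–$22$, $23$–$28$, $29$–$33$, $34$–$37$ (bottom row). The 21 "rows" of the board (lines of cells in the three grid directions) are: horizontal $\{1,2,3,4\}$, $\{5,\dots,9\}$, $\{10,\dots,15\}$, $\{16,\dots,22\}$, $\{23,\dots,28\}$, $\{29,\dots,33\}$, $\{34,\dots,37\}$; up-right $\{1,5,10,16\}$, $\{2,6,11,17,23\}$, $\{3,7,12,18,24,29\}$, $\{4,8,13,19,25,30,34\}$, $\{9,14,20,26,31,35\}$, $\{15,21,27,32,36\}$, $\{22,28,33,37\}$; down-right $\{4,9,15,22\}$, $\{3,8,14,21,28\}$, $\{2,7,13,20,27,33\}$, $\{1,6,12,19,26,32,37\}$, $\{5,11,18,25,31,36\}$, $\{10,17,24,30,35\}$, $\{16,23,29,34\}$. -}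

module Defs where

open import Data.Nat using (ℕ)
open import Data.Fin using (Fin)
open import Data.Fin.Properties using (_≟_)
open import Data.List using (List; []; _∷_; map)
open import Data.List.Relation.Unary.All using (All)
open import Data.List.Relation.Unary.Unique.DecPropositional (_≟_ {7}) using (Unique)
open import Relation.Binary.PropositionalEquality using (_≡_)

-- Cells are labelled 1..37 as in the paper; a labelling is a function from
-- ℕ (only labels 1..37 are ever consulted) to the value set {1..7},
-- represented as Fin 7.
Cell : Set
Cell = ℕ

Value : Set
Value = Fin 7

rows : List (List Cell)
rows =
  (1 ∷ 2 ∷ 3 ∷ 4 ∷ []) ∷
  (5 ∷ 6 ∷ 7 ∷ 8 ∷ 9 ∷ []) ∷
  (10 ∷ 11 ∷ 12 ∷ 13 ∷ 14 ∷ 15 ∷ []) ∷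
  (16 ∷ 17 ∷ 18 ∷ 19 ∷ 20 ∷ 21 ∷ 22 ∷ []) ∷
  (23 ∷ 24 ∷ 25 ∷ 26 ∷ 27 ∷ 28 ∷ []) ∷
  (29 ∷ 30 ∷ 31 ∷ 32 ∷ 33 ∷ []) ∷
  (34 ∷ 35 ∷ 36 ∷ 37 ∷ []) ∷
  (1 ∷ 5 ∷ 10 ∷ 16 ∷ []) ∷
  (2 ∷ 6 ∷ 11 ∷ 17 ∷ 23 ∷ []) ∷
  (3 ∷ 7 ∷ 12 ∷ 18 ∷ 24 ∷ 29 ∷ []) ∷
  (4 ∷ 8 ∷ 13 ∷ 19 ∷ 25 ∷ 30 ∷ 34 ∷ []) ∷
  (9 ∷ 14 ∷ 20 ∷ 26 ∷ 31 ∷ 35 ∷ []) ∷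
  (15 ∷ 21 ∷ 27 ∷ 32 ∷ 36 ∷ []) ∷
  (22 ∷ 28 ∷ 33 ∷ 37 ∷ []) ∷
  (4 ∷ 9 ∷ 15 ∷ 22 ∷ []) ∷
  (3 ∷ 8 ∷ 14 ∷ 21 ∷ 28 ∷ []) ∷
  (2 ∷ 7 ∷ 13 ∷ 20 ∷ 27 ∷ 33 ∷ []) ∷
  (1 ∷ 6 ∷ 12 ∷ 19 ∷ 26 ∷ 32 ∷ 37 ∷ []) ∷
  (5 ∷ 11 ∷ 18 ∷ 25 ∷ 31 ∷ 36 ∷ []) ∷
  (10 ∷ 17 ∷ 24 ∷ 30 ∷ 35 ∷ []) ∷
  (16 ∷ 23 ∷ 29 ∷ 34 ∷ []) ∷
  []

outerCircles : List (List Cell)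
outerCircles =
  (1 ∷ 2 ∷ 5 ∷ 6 ∷ 7 ∷ 11 ∷ 12 ∷ []) ∷
  (3 ∷ 4 ∷ 7 ∷ 8 ∷ 9 ∷ 13 ∷ 14 ∷ []) ∷
  (10 ∷ 11 ∷ 16 ∷ 17 ∷ 18 ∷ 23 ∷ 24 ∷ []) ∷
  (14 ∷ 15 ∷ 20 ∷ 21 ∷ 22 ∷ 27 ∷ 28 ∷ []) ∷
  (24 ∷ 25 ∷ 29 ∷ 30 ∷ 31 ∷ 34 ∷ 35 ∷ []) ∷
  (26 ∷ 27 ∷ 31 ∷ 32 ∷ 33 ∷ 36 ∷ 37 ∷ []) ∷
  []

centralCircle : List Cell
centralCircle = 12 ∷ 13 ∷ 18 ∷ 19 ∷ 20 ∷ 25 ∷ 26 ∷ []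

Distinct : (Cell → Value) → List Cell → Set
Distinct s cs = Unique (map s cs)

-- The central pairs not sharing a row are the six pairs at distance two. If
-- such a pair carried a common value v, then v would occur in every outer
-- circle, as each holds all seven values. The rows through the pair exclude v
-- from all but one or two cells of a suitable outer circle, and putting v in
-- any of those leaves some other outer circle with no cell for v (in four
-- cases after one more such forced step).
module Submission where

open import Data.Fin using (Fin; zero; suc)
open import Data.Fin.Properties using (pigeonhole; <⇒≢; _≟_)
open import Data.List using (List; []; _∷_; length; lookup; map)
open import Data.List.Membership.Propositional using (_∈_)
open import Data.List.Membership.Propositional.Properties using (∈-lookup; ∈-map⁺)
open import Data.List.Properties using (≡-dec; length-map)
open import Data.List.Relation.Unary.All using (All; []; _∷_)
import Data.List.Relation.Unary.All as All
open import Data.List.Relation.Unary.All.Properties using (¬Any⇒All¬; All¬⇒¬Any)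
open import Data.List.Relation.Unary.AllPairs using ([]; _∷_)
open import Data.List.Relation.Unary.Any using (Any; here; there; any?)
import Data.List.Relation.Unary.Any as Any
open import Data.List.Relation.Unary.Any.Properties using (map⁻)
open import Data.List.Relation.Unary.Unique.Propositional using (Unique)
open import Data.Nat using (ℕ; _≤_; _≤?_)
import Data.Nat.Properties as ℕ
open import Data.Empty using (⊥)
open import Data.Product using (_×_; _,_)
open import Function using (_∘_)
open import Relation.Binary.PropositionalEquality using (_≡_; _≢_; refl; sym; trans; cong)
open import Relation.Nullary using (¬_; Dec; yes; no; contradiction)
open import Relation.Nullary.Decidable using (True; toWitness; ¬?; _×-dec_)

open import Defs

import Data.List.Membership.DecPropositional as DecMembership

module _ {a} {A : Set a} where

  lookup-injective : {xs : List A} → Unique xs → ∀ i j → lookup xs i ≡ lookup xs j → i ≡ j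
  lookup-injective (_ ∷ _)    zero    zero    _  = refl
  lookup-injective (x∉xs ∷ _) zero    (suc j) eq = contradiction eq (All.lookup x∉xs (∈-lookup j))
  lookup-injective (x∉xs ∷ _) (suc i) zero    eq = contradiction (sym eq) (All.lookup x∉xs (∈-lookup i))
  lookup-injective (_ ∷ u)    (suc i) (suc j) eq = cong suc (lookup-injective u i j eq)

  map-injectiveOn : ∀ {b} {B : Set b} (f : A → B) {xs : List A} {x y : A} →
                    Unique (map f xs) → x ∈ xs → y ∈ xs → f x ≡ f y → x ≡ y
  map-injectiveOn f u         (here refl) (here refl) _  = refl
  map-injectiveOn f (fx∉ ∷ _) (here refl) (there y∈) eq = contradiction eq (All.lookup fx∉ (∈-map⁺ f y∈))
  map-injectiveOn f (fy∉ ∷ _) (there x∈) (here refl) eq = contradiction (sym eq) (All.lookup fy∉ (∈-map⁺ f x∈))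
  map-injectiveOn f (_ ∷ u)   (there x∈) (there y∈) eq = map-injectiveOn f u x∈ y∈ eq

module _ {n : ℕ} where

  open DecMembership (_≟_ {n}) using (_∈?_)

  Unique⇒length≤ : {xs : List (Fin n)} → Unique xs → length xs ≤ n
  Unique⇒length≤ {xs} u with length xs ≤? n
  ... | yes len≤n = len≤n
  ... | no  len≰n with pigeonhole (ℕ.≰⇒> len≰n) (lookup xs)
  ...   | i , j , i<j , eq = contradiction (lookup-injective u i j eq) (<⇒≢ i<j)

  Unique∧length≡⇒∈ : {xs : List (Fin n)} → Unique xs → length xs ≡ n → ∀ v → v ∈ xs
  Unique∧length≡⇒∈ {xs} u len≡n v with v ∈? xs
  ... | yes v∈xs = v∈xs
  ... | no  v∉xs = contradiction (Unique⇒length≤ (¬Any⇒All¬ xs v∉xs ∷ u)) (ℕ.<-irrefl len≡n)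

open DecMembership ℕ._≟_ using () renaming (_∈?_ to _∈ᶜ?_)
open DecMembership (≡-dec ℕ._≟_) using () renaming (_∈?_ to _∈ᴿ?_)

Collinear : Cell → Cell → Set
Collinear c d = c ≢ d × Any (λ r → c ∈ r × d ∈ r) rows

collinear? : (c d : Cell) → Dec (Collinear c d)
collinear? c d = ¬? (c ℕ.≟ d) ×-dec any? (λ r → (c ∈ᶜ? r) ×-dec (d ∈ᶜ? r)) rows

outerCircles-length : All (λ cs → length cs ≡ 7) outerCircles
outerCircles-length = refl ∷ refl ∷ refl ∷ refl ∷ refl ∷ refl ∷ []

module Board (s : Cell → Value)
             (rows-distinct : All (Distinct s) rows)
             (circles-distinct : All (Distinct s) outerCircles) where

  collinear⇒≢ : ∀ {c d} → Collinear c d → s c ≢ s d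
  collinear⇒≢ (c≢d , on-row) with All.lookupAny rows-distinct on-row
  ... | row-distinct , c∈r , d∈r = c≢d ∘ map-injectiveOn s row-distinct c∈r d∈r

  apart : ∀ {c d} {col : True (collinear? c d)} → s c ≢ s d
  apart {col = col} = collinear⇒≢ (toWitness col)

  _sees_ : ∀ c {d v} {col : True (collinear? c d)} → s d ≡ v → s c ≢ v
  _sees_ c {col = col} d↦v c↦v = apart {col = col} (trans c↦v (sym d↦v))

  unshared : ∀ {c d} → (∀ {v} → s c ≡ v → s d ≡ v → ⊥) → s c ≢ s d
  unshared ¬shared c≡d = ¬shared c≡d refl

  -- The circle is inferred from the cells listed in the refutation.
  no-room : ∀ {v cs} {_ : True (cs ∈ᴿ? outerCircles)} → ¬ All (λ c → s c ≢ v) cs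
  no-room {v} {cs} {circle} avoids-v = All¬⇒¬Any avoids-v (Any.map sym (map⁻ v∈circle))
    where
    cs∈ : cs ∈ outerCircles
    cs∈ = toWitness circle
    v∈circle : v ∈ map s cs
    v∈circle = Unique∧length≡⇒∈ (All.lookup circles-distinct cs∈)
                 (trans (length-map s cs) (All.lookup outerCircles-length cs∈)) v

  ¬shared-12-20 : ∀ {v} → s 12 ≡ v → s 20 ≡ v → ⊥
  ¬shared-12-20 {v} 12↦v 20↦v =
    no-room (3 sees 12↦v ∷ ¬4↦v ∷ 7 sees 12↦v ∷ ¬8↦v ∷ 9 sees 20↦v ∷ 13 sees 12↦v ∷ 14 sees 12↦v ∷ [])
    where
    ¬4↦v : s 4 ≢ v
    ¬4↦v 4↦v =
      no-room (24 sees 12↦v ∷ 25 sees 4↦v ∷ 29 sees 12↦v ∷ 30 sees 4↦v ∷ 31 sees 20↦v ∷ 34 sees 4↦v ∷ 35 sees 20↦v ∷ [])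
    ¬8↦v : s 8 ≢ v
    ¬8↦v 8↦v =
      no-room (24 sees 12↦v ∷ 25 sees 8↦v ∷ 29 sees 12↦v ∷ 30 sees 8↦v ∷ 31 sees 20↦v ∷ 34 sees 8↦v ∷ 35 sees 20↦v ∷ [])

  ¬shared-12-25 : ∀ {v} → s 12 ≡ v → s 25 ≡ v → ⊥
  ¬shared-12-25 {v} 12↦v 25↦v =
    no-room (3 sees 12↦v ∷ 4 sees 25↦v ∷ 7 sees 12↦v ∷ 8 sees 25↦v ∷ ¬9↦v ∷ 13 sees 25↦v ∷ 14 sees 12↦v ∷ [])
    where
    ¬9↦v : s 9 ≢ v
    ¬9↦v 9↦v =
      no-room (14 sees 12↦v ∷ 15 sees 12↦v ∷ 20 sees 9↦v ∷ ¬21↦v ∷ 22 sees 9↦v ∷ 27 sees 25↦v ∷ 28 sees 25↦v ∷ [])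
      where
      ¬21↦v : s 21 ≢ v
      ¬21↦v 21↦v =
        no-room (10 sees 12↦v ∷ 11 sees 25↦v ∷ 16 sees 21↦v ∷ 17 sees 21↦v ∷ 18 sees 25↦v ∷ 23 sees 25↦v ∷ 24 sees 25↦v ∷ [])

  ¬shared-13-18 : ∀ {v} → s 13 ≡ v → s 18 ≡ v → ⊥
  ¬shared-13-18 {v} 13↦v 18↦v =
    no-room (¬1↦v ∷ 2 sees 13↦v ∷ 5 sees 18↦v ∷ ¬6↦v ∷ 7 sees 18↦v ∷ 11 sees 18↦v ∷ 12 sees 18↦v ∷ [])
    where
    ¬1↦v : s 1 ≢ v
    ¬1↦v 1↦v =
      no-room (26 sees 1↦v ∷ 27 sees 13↦v ∷ 31 sees 18↦v ∷ 32 sees 1↦v ∷ 33 sees 13↦v ∷ 36 sees 18↦v ∷ 37 sees 1↦v ∷ [])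
    ¬6↦v : s 6 ≢ v
    ¬6↦v 6↦v =
      no-room (26 sees 6↦v ∷ 27 sees 13↦v ∷ 31 sees 18↦v ∷ 32 sees 6↦v ∷ 33 sees 13↦v ∷ 36 sees 18↦v ∷ 37 sees 6↦v ∷ [])

  ¬shared-13-26 : ∀ {v} → s 13 ≡ v → s 26 ≡ v → ⊥
  ¬shared-13-26 {v} 13↦v 26↦v =
    no-room (1 sees 26↦v ∷ 2 sees 13↦v ∷ ¬5↦v ∷ 6 sees 26↦v ∷ 7 sees 13↦v ∷ 11 sees 13↦v ∷ 12 sees 26↦v ∷ [])
    where
    ¬5↦v : s 5 ≢ v
    ¬5↦v 5↦v =
      no-room (10 sees 5↦v ∷ 11 sees 5↦v ∷ 16 sees 5↦v ∷ ¬17↦v ∷ 18 sees 5↦v ∷ 23 sees 26↦v ∷ 24 sees 26↦v ∷ [])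
      where
      ¬17↦v : s 17 ≢ v
      ¬17↦v 17↦v =
        no-room (14 sees 26↦v ∷ 15 sees 13↦v ∷ 20 sees 17↦v ∷ 21 sees 17↦v ∷ 22 sees 17↦v ∷ 27 sees 26↦v ∷ 28 sees 26↦v ∷ [])

  ¬shared-18-26 : ∀ {v} → s 18 ≡ v → s 26 ≡ v → ⊥
  ¬shared-18-26 {v} 18↦v 26↦v =
    no-room (1 sees 26↦v ∷ ¬2↦v ∷ 5 sees 18↦v ∷ 6 sees 26↦v ∷ 7 sees 18↦v ∷ 11 sees 18↦v ∷ 12 sees 18↦v ∷ [])
    where
    ¬2↦v : s 2 ≢ v
    ¬2↦v 2↦v =
      no-room (3 sees 2↦v ∷ 4 sees 2↦v ∷ 7 sees 2↦v ∷ ¬8↦v ∷ 9 sees 26↦v ∷ 13 sees 2↦v ∷ 14 sees 26↦v ∷ [])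
      where
      ¬8↦v : s 8 ≢ v
      ¬8↦v 8↦v =
        no-room (24 sees 18↦v ∷ 25 sees 8↦v ∷ 29 sees 18↦v ∷ 30 sees 8↦v ∷ 31 sees 18↦v ∷ 34 sees 8↦v ∷ 35 sees 26↦v ∷ [])

  ¬shared-20-25 : ∀ {v} → s 20 ≡ v → s 25 ≡ v → ⊥
  ¬shared-20-25 {v} 20↦v 25↦v =
    no-room (¬3↦v ∷ 4 sees 25↦v ∷ 7 sees 20↦v ∷ 8 sees 25↦v ∷ 9 sees 20↦v ∷ 13 sees 25↦v ∷ 14 sees 20↦v ∷ [])
    where
    ¬3↦v : s 3 ≢ v
    ¬3↦v 3↦v =
      no-room (1 sees 3↦v ∷ 2 sees 3↦v ∷ 5 sees 25↦v ∷ ¬6↦v ∷ 7 sees 3↦v ∷ 11 sees 25↦v ∷ 12 sees 3↦v ∷ [])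
      where
      ¬6↦v : s 6 ≢ v
      ¬6↦v 6↦v =
        no-room (26 sees 25↦v ∷ 27 sees 25↦v ∷ 31 sees 25↦v ∷ 32 sees 6↦v ∷ 33 sees 20↦v ∷ 36 sees 25↦v ∷ 37 sees 6↦v ∷ [])

theorem8 : (s : Cell → Value) →
           All (Distinct s) rows →
           All (Distinct s) outerCircles →
           Distinct s centralCircle
theorem8 s rows-distinct circles-distinct =
    (apart ∷ apart ∷ apart ∷ unshared ¬shared-12-20 ∷ unshared ¬shared-12-25 ∷ apart ∷ [])
  ∷ (unshared ¬shared-13-18 ∷ apart ∷ apart ∷ apart ∷ unshared ¬shared-13-26 ∷ [])
  ∷ (apart ∷ apart ∷ apart ∷ unshared ¬shared-18-26 ∷ [])
  ∷ (apart ∷ apart ∷ apart ∷ [])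
  ∷ (unshared ¬shared-20-25 ∷ apart ∷ [])
  ∷ (apart ∷ [])
  ∷ []
  ∷ []
  where open Board s rows-distinct circles-distinct
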